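{- Let $n\ge4$. (i) For pairwise distinct natural numbers $a,b,c$ with $1\le a,b,c\le n-2$ and $a+b+c=n-1$, the necklaces $[a,b,c,n,c,b,a,n]$ and $[a,b,c,n-1,c,b,a,n-1]$ are topdrop-valid in $S_n$. (ii) For pairwise distinct natural numbers $a,b,c$ with $1\le a,b,c\le n-2$, $a+b+c\ne n-1$, $a+b\ne n-1$ and $b+c\ne n-1$, the necklace $[a,b,c,n-1,c,b,a,n]$ is topdrop-valid in $S_n$.
   Context: Permutations are in one-line notation $\pi=\pi_1\cdots\pi_n$. The topdrop map $T:S_n\to S_n$ is $T(\pi_1\cdots\pi_n)=\pi_{\pi_1+1}\cdots\pi_n\,\pi_{\pi_1}\pi_{\pi_1-1}\cdots\pi_1$ (first $\pi_1$ entries removed, reversed, appended at the end); it is a bijection. The orbit of $\pi$ is $(\pi,T(\pi),\dots,T^{s-1}(\pi))$ with $s\ge1$ minimal such that $T^s(\pi)=\pi$. The topdrop-necklace of $\pi$ is the cyclic sequence $[\pi_1,T(\pi)_1,\dots,T^{s-1}(\pi)_1]$, considered up to cyclic rotation; its size is $s$. A necklace is topdrop-valid in $S_n$ if it is the topdrop-necklace of some $\pi\in S_n$. -}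

module Defs where

open import Data.Nat using (ℕ; zero; suc; _≤_; _<_)
open import Data.List using (List; []; _∷_; _++_; drop; take; reverse; map; upTo; length)
open import Data.List.Relation.Binary.Permutation.Propositional using (_↭_)
open import Data.Product using (Σ; _×_; ∃; ∃-syntax)
open import Relation.Binary.PropositionalEquality using (_≡_; _≢_)

-- Permutations of [n] in one-line notation: lists that are a rearrangement of 1,2,…,n.
oneToN : ℕ → List ℕ
oneToN n = map suc (upTo n)

InS : ℕ → List ℕ → Set
InS n π = π ↭ oneToN n

-- first entry (default 0 for the empty list; never used on elements of S_n, n ≥ 1)
first : List ℕ → ℕ
first []      = 0
first (x ∷ _) = x

topdrop : List ℕ → List ℕ
topdrop []       = []
topdrop (x ∷ xs) = drop x (x ∷ xs) ++ reverse (take x (x ∷ xs))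

topdropIter : ℕ → List ℕ → List ℕ
topdropIter zero    π = π
topdropIter (suc i) π = topdrop (topdropIter i π)

IsOrbitSize : List ℕ → ℕ → Set
IsOrbitSize π s =
  (1 ≤ s) × (topdropIter s π ≡ π) × (∀ t → 1 ≤ t → t < s → topdropIter t π ≢ π)

necklaceSeq : List ℕ → ℕ → List ℕ
necklaceSeq π s = map (λ i → first (topdropIter i π)) (upTo s)

SameUpToRotation : List ℕ → List ℕ → Set
SameUpToRotation L M = ∃[ k ] ((k ≤ length L) × (drop k L ++ take k L ≡ M))

IsTopdropNecklaceOf : List ℕ → List ℕ → Set
IsTopdropNecklaceOf N π = ∃[ s ] (IsOrbitSize π s × SameUpToRotation (necklaceSeq π s) N)

TopdropValid : ℕ → List ℕ → Set
TopdropValid n N = ∃[ π ] (InS n π × IsTopdropNecklaceOf N π)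

{-# OPTIONS --safe #-}
-- Write T for topdrop. If σ ∈ Sₙ then topdrop (reverse (Tσ)) = reverse σ, and if σ begins with
-- n - 1 or n then Tσ = reverse σ. So if T³π begins with d ∈ {n - 1, n}, then T⁴⁺ʲπ = reverse (T³⁻ʲπ)
-- for j ≤ 3, and if moreover π ends with e ∈ {n - 1, n}, then T⁸π = T (reverse π) = π: the necklace
-- of π is [a, b, c, d, c, b, a, e], where a, b, c are the first entries of π, Tπ, T²π, and the
-- distinctness hypotheses rule out a shorter period.
--
-- These conditions prescribe the entries of π at explicit positions. Comparing a + b, b + c and
-- a + b + c with n - 1 fixes the order of these positions, and the hypotheses keep them distinct;
-- π is then built by inserting a, b, c, d, e there into the remaining numbers of [n].
module Submission where

open import Defs
open import Data.Nat using (ℕ; zero; suc; _+_; _∸_; _≤_; _<_; z≤n; s≤s; _<?_; z<s; s≤s⁻¹; >-nonZero)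
open import Data.Nat.Properties
open import Data.List using (List; []; _∷_; _++_; drop; take; reverse; map; length; upTo; [_])
open import Data.List.Properties
  using (length-++; length-take; length-drop; length-map; length-upTo; length-reverse; take++drop≡id;
         reverse-++; reverse-involutive; unfold-reverse)
open import Data.List.Relation.Binary.Permutation.Propositional
  using (_↭_; ↭-refl; ↭-trans; ↭-sym; ↭-reflexive; prep; swap; module PermutationReasoning)
open import Data.List.Relation.Binary.Permutation.Propositional.Properties
  using (++⁺ˡ; ++⁺ʳ; ++-comm; shift; ↭-reverse; ∈-resp-↭; ↭-length; All-resp-↭)
  renaming (map⁺ to ↭-map⁺)
open import Data.List.Membership.Propositional using (_∈_)
open import Data.List.Membership.Propositional.Properties using (∈-map⁺; ∈-map⁻; ∈-upTo⁺; ∈-upTo⁻; ∈-∃++)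
open import Data.List.Relation.Unary.Any using (here; there)
open import Data.List.Relation.Unary.All using (All; []; _∷_; zipWith)
import Data.List.Relation.Unary.All.Properties as All
open import Data.List.Relation.Unary.AllPairs using (AllPairs; []; _∷_)
import Data.List.Relation.Unary.AllPairs as AllPairs
open import Data.List.Relation.Unary.Linked using (Linked; []; [-]; _∷_)
import Data.List.Relation.Unary.Linked as Linked
open import Data.List.Relation.Unary.Linked.Properties using (Linked⇒AllPairs)
open import Data.Sum using (inj₁; inj₂)
open import Data.Product using (_×_; _,_; proj₁; proj₂; ∃-syntax)
open import Relation.Nullary using (yes; no; contradiction)
open import Relation.Binary.Definitions using (tri<; tri≈; tri>)
open import Relation.Binary.PropositionalEquality
  using (_≡_; _≢_; ≢-sym; refl; sym; trans; cong; cong₂; subst; subst₂; module ≡-Reasoning)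

nth : List ℕ → ℕ → ℕ
nth []       _       = 0
nth (x ∷ _)  zero    = x
nth (_ ∷ xs) (suc i) = nth xs i

first≡nth-0 : ∀ L → first L ≡ nth L 0
first≡nth-0 []      = refl
first≡nth-0 (_ ∷ _) = refl

nth-++ˡ : ∀ xs ys {i} → i < length xs → nth (xs ++ ys) i ≡ nth xs i
nth-++ˡ (x ∷ xs) ys {zero}  _         = refl
nth-++ˡ (x ∷ xs) ys {suc i} (s≤s i<n) = nth-++ˡ xs ys i<n

nth-++ʳ : ∀ xs ys i → nth (xs ++ ys) (length xs + i) ≡ nth ys i
nth-++ʳ []       ys i = refl
nth-++ʳ (x ∷ xs) ys i = nth-++ʳ xs ys i

nth-++-∷ : ∀ xs y ys → nth (xs ++ y ∷ ys) (length xs) ≡ y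
nth-++-∷ []       y ys = refl
nth-++-∷ (x ∷ xs) y ys = nth-++-∷ xs y ys

nth-reverse : ∀ xs {i} → i < length xs → nth (reverse xs) i ≡ nth xs (length xs ∸ suc i)
nth-reverse (x ∷ xs) {i} i≤n rewrite unfold-reverse x xs with m<1+n⇒m<n∨m≡n i≤n
... | inj₁ i<n = begin
  nth (reverse xs ++ [ x ]) i      ≡⟨ nth-++ˡ (reverse xs) [ x ] (subst (i <_) (sym (length-reverse xs)) i<n) ⟩
  nth (reverse xs) i               ≡⟨ nth-reverse xs i<n ⟩
  nth xs (length xs ∸ suc i)       ≡⟨ cong (nth (x ∷ xs)) (+-∸-assoc 1 i<n) ⟨
  nth (x ∷ xs) (length xs ∸ i)     ∎
  where open ≡-Reasoning
... | inj₂ refl = begin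
  nth (reverse xs ++ [ x ]) (length xs)            ≡⟨ cong (nth (reverse xs ++ [ x ])) (length-reverse xs) ⟨
  nth (reverse xs ++ [ x ]) (length (reverse xs))  ≡⟨ nth-++-∷ (reverse xs) x [] ⟩
  x                                                ≡⟨ cong (nth (x ∷ xs)) (n∸n≡0 (length xs)) ⟨
  nth (x ∷ xs) (length xs ∸ length xs)             ∎
  where open ≡-Reasoning

-- Positions are 0-based: entry i of topdrop L is entry topdropIndex n k i of L, if L has length n
-- and first entry k ≤ n.
topdropIndex : ℕ → ℕ → ℕ → ℕ
topdropIndex n k i with k + i <? n
... | yes _ = k + i
... | no  _ = n ∸ suc i

topdropIndex-< : ∀ {n} k i → k + i < n → topdropIndex n k i ≡ k + i
topdropIndex-< {n} k i k+i<n with k + i <? n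
... | yes _     = refl
... | no  k+i≮n = contradiction k+i<n k+i≮n

topdropIndex-≥ : ∀ {n} k i → n ≤ k + i → topdropIndex n k i ≡ n ∸ suc i
topdropIndex-≥ {n} k i n≤k+i with k + i <? n
... | yes k+i<n = contradiction n≤k+i (<⇒≱ k+i<n)
... | no  _     = refl

topdropIndex<n : ∀ n k {i} → i < n → topdropIndex n k i < n
topdropIndex<n n k {i} i<n with k + i <? n
... | yes k+i<n = k+i<n
... | no  _     = ∸-monoʳ-< z<s i<n

nth-++-reverse : ∀ X Y {i} → i < length X + length Y →
  nth (Y ++ reverse X) i ≡ nth (X ++ Y) (topdropIndex (length X + length Y) (length X) i)
nth-++-reverse X Y {i} i<n with length X + i <? length X + length Y
... | yes p+i<n = begin
  nth (Y ++ reverse X) i    ≡⟨ nth-++ˡ Y (reverse X) (+-cancelˡ-< (length X) i (length Y) p+i<n) ⟩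
  nth Y i                   ≡⟨ nth-++ʳ X Y i ⟨
  nth (X ++ Y) (length X + i) ∎
  where open ≡-Reasoning
... | no p+i≮n = begin
  nth (Y ++ reverse X) i        ≡⟨ cong (nth (Y ++ reverse X)) i≡r+j ⟩
  nth (Y ++ reverse X) (r + j)  ≡⟨ nth-++ʳ Y (reverse X) j ⟩
  nth (reverse X) j             ≡⟨ nth-reverse X j<p ⟩
  nth X (p ∸ suc j)             ≡⟨ nth-++ˡ X Y (∸-monoʳ-< z<s j<p) ⟨
  nth (X ++ Y) (p ∸ suc j)      ≡⟨ cong (nth (X ++ Y)) reflected ⟨
  nth (X ++ Y) ((p + r) ∸ suc i) ∎
  where
  open ≡-Reasoning
  p = length X
  r = length Y
  j = i ∸ r
  r≤i : r ≤ i
  r≤i = +-cancelˡ-≤ p r i (≮⇒≥ p+i≮n)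
  i≡r+j : i ≡ r + j
  i≡r+j = sym (m+[n∸m]≡n r≤i)
  j<p : j < p
  j<p = +-cancelˡ-< r j p (subst₂ _<_ i≡r+j (+-comm p r) i<n)
  reflected : (p + r) ∸ suc i ≡ p ∸ suc j
  reflected = begin
    (p + r) ∸ suc i         ≡⟨ cong₂ (λ s t → s ∸ suc t) (+-comm p r) i≡r+j ⟩
    (r + p) ∸ suc (r + j)   ≡⟨ cong ((r + p) ∸_) (+-suc r j) ⟨
    (r + p) ∸ (r + suc j)   ≡⟨ [m+n]∸[m+o]≡n∸o r p (suc j) ⟩
    p ∸ suc j               ∎

topdrop-split : ∀ L → topdrop L ≡ drop (first L) L ++ reverse (take (first L) L)
topdrop-split []      = refl
topdrop-split (_ ∷ _) = refl

length-take-≤ : ∀ {k} (L : List ℕ) → k ≤ length L → length (take k L) ≡ k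
length-take-≤ {k} L k≤n = trans (length-take k L) (m≤n⇒m⊓n≡m k≤n)

nth-topdrop : ∀ L {i} → first L ≤ length L → i < length L →
  nth (topdrop L) i ≡ nth L (topdropIndex (length L) (first L) i)
nth-topdrop L {i} k≤n i<n = begin
  nth (topdrop L) i
    ≡⟨ cong (λ σ → nth σ i) (topdrop-split L) ⟩
  nth (Y ++ reverse X) i
    ≡⟨ nth-++-reverse X Y (subst (i <_) (sym |X|+|Y|≡n) i<n) ⟩
  nth (X ++ Y) (topdropIndex (length X + length Y) (length X) i)
    ≡⟨ cong₂ (λ σ n → nth σ (topdropIndex n (length X) i)) (take++drop≡id k L) |X|+|Y|≡n ⟩
  nth L (topdropIndex (length L) (length X) i)
    ≡⟨ cong (λ k → nth L (topdropIndex (length L) k i)) (length-take-≤ L k≤n) ⟩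
  nth L (topdropIndex (length L) k i)
    ∎
  where
  open ≡-Reasoning
  k = first L
  X = take k L
  Y = drop k L
  |X|+|Y|≡n : length X + length Y ≡ length L
  |X|+|Y|≡n = trans (sym (length-++ X)) (cong length (take++drop≡id k L))

topdrop-↭ : ∀ L → topdrop L ↭ L
topdrop-↭ L = begin
  topdrop L                                 ≡⟨ topdrop-split L ⟩
  drop k L ++ reverse (take k L)            ↭⟨ ++⁺ˡ (drop k L) (↭-reverse (take k L)) ⟩
  drop k L ++ take k L                      ↭⟨ ++-comm (drop k L) (take k L) ⟩
  take k L ++ drop k L                      ≡⟨ take++drop≡id k L ⟩
  L                                         ∎
  where
  open PermutationReasoning
  k = first L

length-oneToN : ∀ n → length (oneToN n) ≡ n
length-oneToN n = trans (length-map suc (upTo n)) (length-upTo n)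

length-InS : ∀ {n π} → InS n π → length π ≡ n
length-InS {n} π↭ = trans (↭-length π↭) (length-oneToN n)

topdrop-InS : ∀ {n π} → InS n π → InS n (topdrop π)
topdrop-InS {π = π} π↭ = ↭-trans (topdrop-↭ π) π↭

first-InS : ∀ {m π} → InS (suc m) π → 1 ≤ first π × first π ≤ suc m
first-InS {π = []}    π↭ = contradiction (↭-length π↭) λ ()
first-InS {π = x ∷ _} π↭ with ∈-map⁻ suc (∈-resp-↭ π↭ (here refl))
... | y , y∈ , refl = s≤s z≤n , ∈-upTo⁻ y∈

take-++-length : ∀ (X Z : List ℕ) → take (length X) (X ++ Z) ≡ X
take-++-length []      Z = refl
take-++-length (x ∷ X) Z = cong (x ∷_) (take-++-length X Z)

drop-++-length : ∀ (X Z : List ℕ) → drop (length X) (X ++ Z) ≡ Z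
drop-++-length []      Z = refl
drop-++-length (x ∷ X) Z = drop-++-length X Z

topdrop-++ : ∀ X Z → first (X ++ Z) ≡ length X → topdrop (X ++ Z) ≡ Z ++ reverse X
topdrop-++ X Z first≡|X| = begin
  topdrop (X ++ Z)
    ≡⟨ topdrop-split (X ++ Z) ⟩
  drop k (X ++ Z) ++ reverse (take k (X ++ Z))
    ≡⟨ cong (λ k → drop k (X ++ Z) ++ reverse (take k (X ++ Z))) first≡|X| ⟩
  drop (length X) (X ++ Z) ++ reverse (take (length X) (X ++ Z))
    ≡⟨ cong₂ (λ D T → D ++ reverse T) (drop-++-length X Z) (take-++-length X Z) ⟩
  Z ++ reverse X
    ∎
  where
  open ≡-Reasoning
  k = first (X ++ Z)

reverse-topdrop : ∀ L → reverse (topdrop L) ≡ take (first L) L ++ reverse (drop (first L) L)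
reverse-topdrop L = begin
  reverse (topdrop L)                                 ≡⟨ cong reverse (topdrop-split L) ⟩
  reverse (drop k L ++ reverse (take k L))            ≡⟨ reverse-++ (drop k L) (reverse (take k L)) ⟩
  reverse (reverse (take k L)) ++ reverse (drop k L)  ≡⟨ cong (_++ reverse (drop k L)) (reverse-involutive (take k L)) ⟩
  take k L ++ reverse (drop k L)                      ∎
  where
  open ≡-Reasoning
  k = first L

first-reverse-topdrop : ∀ L → 1 ≤ first L → first (reverse (topdrop L)) ≡ first L
first-reverse-topdrop L@(suc _ ∷ _) _ = cong first (reverse-topdrop L)

topdrop-reverse-topdrop : ∀ L → 1 ≤ first L → first L ≤ length L →
  topdrop (reverse (topdrop L)) ≡ reverse L
topdrop-reverse-topdrop L 1≤k k≤n = begin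
  topdrop (reverse (topdrop L))                ≡⟨ cong topdrop (reverse-topdrop L) ⟩
  topdrop (take k L ++ reverse (drop k L))     ≡⟨ topdrop-++ (take k L) _ first≡|X| ⟩
  reverse (drop k L) ++ reverse (take k L)     ≡⟨ reverse-++ (take k L) (drop k L) ⟨
  reverse (take k L ++ drop k L)               ≡⟨ cong reverse (take++drop≡id k L) ⟩
  reverse L                                    ∎
  where
  open ≡-Reasoning
  k = first L
  first≡|X| : first (take k L ++ reverse (drop k L)) ≡ length (take k L)
  first≡|X| = trans (trans (cong first (sym (reverse-topdrop L))) (first-reverse-topdrop L 1≤k))
                    (sym (length-take-≤ L k≤n))

reverse-short : ∀ (xs : List ℕ) → length xs ≤ 1 → reverse xs ≡ xs
reverse-short []          _ = refl
reverse-short (_ ∷ [])    _ = refl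
reverse-short (_ ∷ _ ∷ _) (s≤s ())

topdrop≡reverse : ∀ L → length L ≤ suc (first L) → topdrop L ≡ reverse L
topdrop≡reverse L n≤1+k = begin
  topdrop L                                    ≡⟨ topdrop-split L ⟩
  drop k L ++ reverse (take k L)               ≡⟨ cong (_++ reverse (take k L)) (reverse-short (drop k L) |drop|≤1) ⟨
  reverse (drop k L) ++ reverse (take k L)     ≡⟨ reverse-++ (take k L) (drop k L) ⟨
  reverse (take k L ++ drop k L)               ≡⟨ cong reverse (take++drop≡id k L) ⟩
  reverse L                                    ∎
  where
  open ≡-Reasoning
  k = first L
  |drop|≤1 : length (drop k L) ≤ 1
  |drop|≤1 = subst (_≤ 1) (sym (length-drop k L))
               (m≤n+o⇒m∸n≤o (length L) k (subst (length L ≤_) (+-comm 1 k) n≤1+k))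

first-reverse : ∀ L → first (reverse L) ≡ nth L (length L ∸ 1)
first-reverse []      = refl
first-reverse (x ∷ L) = trans (first≡nth-0 (reverse (x ∷ L))) (nth-reverse (x ∷ L) z<s)

topdropIter-+ : ∀ i t π → topdropIter (i + t) π ≡ topdropIter i (topdropIter t π)
topdropIter-+ zero    t π = refl
topdropIter-+ (suc i) t π = cong topdrop (topdropIter-+ i t π)

first-periodic : ∀ {t π} → topdropIter t π ≡ π →
  ∀ i → first (topdropIter (i + t) π) ≡ first (topdropIter i π)
first-periodic {t} {π} Tᵗπ≡π i = cong first (trans (topdropIter-+ i t π) (cong (topdropIter i) Tᵗπ≡π))

palindromic-necklace : ∀ {m π a b c d e} → InS (suc m) π →
  first π ≡ a → first (topdropIter 1 π) ≡ b → first (topdropIter 2 π) ≡ c →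
  first (topdropIter 3 π) ≡ d → first (reverse π) ≡ e → m ≤ d → m ≤ e →
  b ≢ a → c ≢ a → d ≢ a → e ≢ a → e ≢ b →
  TopdropValid (suc m) (a ∷ b ∷ c ∷ d ∷ c ∷ b ∷ a ∷ e ∷ [])
palindromic-necklace {m} {π} {a} {b} {c} {d} {e} π∈S f₀ f₁ f₂ f₃ fₑ m≤d m≤e b≢a c≢a d≢a e≢a e≢b =
  π , π∈S , 8 , (s≤s z≤n , T⁸π≡π , aperiodic) , 0 , z≤n , necklace
  where
  T : ℕ → List ℕ
  T k = topdropIter k π

  Tᵏπ∈S : ∀ k → InS (suc m) (T k)
  Tᵏπ∈S zero    = π∈S
  Tᵏπ∈S (suc k) = topdrop-InS (Tᵏπ∈S k)

  full-reversal : ∀ {L} → InS (suc m) L → m ≤ first L → topdrop L ≡ reverse L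
  full-reversal {L} L∈S m≤k =
    topdrop≡reverse L (subst (_≤ suc (first L)) (sym (length-InS L∈S)) (s≤s m≤k))

  first-bounds : ∀ k → 1 ≤ first (T k) × first (T k) ≤ length (T k)
  first-bounds k with 1≤k , k≤n ← first-InS (Tᵏπ∈S k) =
    1≤k , subst (first (T k) ≤_) (sym (length-InS (Tᵏπ∈S k))) k≤n

  undo : ∀ k → topdrop (reverse (T (suc k))) ≡ reverse (T k)
  undo k = topdrop-reverse-topdrop (T k) (proj₁ (first-bounds k)) (proj₂ (first-bounds k))

  first-undo : ∀ k → first (reverse (T (suc k))) ≡ first (T k)
  first-undo k = first-reverse-topdrop (T k) (proj₁ (first-bounds k))

  T⁴π : T 4 ≡ reverse (T 3)
  T⁴π = full-reversal (Tᵏπ∈S 3) (subst (m ≤_) (sym f₃) m≤d)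
  T⁵π : T 5 ≡ reverse (T 2)
  T⁵π = trans (cong topdrop T⁴π) (undo 2)
  T⁶π : T 6 ≡ reverse (T 1)
  T⁶π = trans (cong topdrop T⁵π) (undo 1)
  T⁷π : T 7 ≡ reverse π
  T⁷π = trans (cong topdrop T⁶π) (undo 0)

  T⁸π≡π : T 8 ≡ π
  T⁸π≡π = begin
    T 8                      ≡⟨ cong topdrop T⁷π ⟩
    topdrop (reverse π)      ≡⟨ full-reversal (↭-trans (↭-reverse π) π∈S) (subst (m ≤_) (sym fₑ) m≤e) ⟩
    reverse (reverse π)      ≡⟨ reverse-involutive π ⟩
    π                        ∎
    where open ≡-Reasoning

  f₄ : first (T 4) ≡ c
  f₄ = trans (cong first T⁴π) (trans (first-undo 2) f₂)
  f₅ : first (T 5) ≡ b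
  f₅ = trans (cong first T⁵π) (trans (first-undo 1) f₁)
  f₆ : first (T 6) ≡ a
  f₆ = trans (cong first T⁶π) (trans (first-undo 0) f₀)
  f₇ : first (T 7) ≡ e
  f₇ = trans (cong first T⁷π) fₑ

  shifted : ∀ t i {x y} → first (T (i + t)) ≡ x → first (T i) ≡ y → x ≢ y → T t ≢ π
  shifted t i fx fy x≢y Tᵗπ≡π = x≢y (trans (sym fx) (trans (first-periodic Tᵗπ≡π i) fy))

  aperiodic : ∀ t → 1 ≤ t → t < 8 → T t ≢ π
  aperiodic 1 _ _ = shifted 1 0 f₁ f₀ b≢a
  aperiodic 2 _ _ = shifted 2 0 f₂ f₀ c≢a
  aperiodic 3 _ _ = shifted 3 0 f₃ f₀ d≢a
  aperiodic 4 _ _ = shifted 4 0 f₄ f₀ c≢a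
  aperiodic 5 _ _ = shifted 5 0 f₅ f₀ b≢a
  aperiodic 6 _ _ = shifted 6 1 f₇ f₁ e≢b
  aperiodic 7 _ _ = shifted 7 0 f₇ f₀ e≢a
  aperiodic (suc (suc (suc (suc (suc (suc (suc (suc _)))))))) _
    (s≤s (s≤s (s≤s (s≤s (s≤s (s≤s (s≤s (s≤s ()))))))))

  necklace : drop 0 (necklaceSeq π 8) ++ take 0 (necklaceSeq π 8)
           ≡ a ∷ b ∷ c ∷ d ∷ c ∷ b ∷ a ∷ e ∷ []
  necklace = cong₂ _∷_ f₀ (cong₂ _∷_ f₁ (cong₂ _∷_ f₂ (cong₂ _∷_ f₃
             (cong₂ _∷_ f₄ (cong₂ _∷_ f₅ (cong₂ _∷_ f₆ (cong₂ _∷_ f₇ refl)))))))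

topdropIndex-0 : ∀ {n k} → k < n → topdropIndex n k 0 ≡ k
topdropIndex-0 {k = k} k<n =
  trans (topdropIndex-< k 0 (subst (_< _) (sym (+-identityʳ k)) k<n)) (+-identityʳ k)

nth-topdrop-InS : ∀ {m L k i} → InS (suc m) L → first L ≡ k → i < suc m →
  nth (topdrop L) i ≡ nth L (topdropIndex (suc m) k i)
nth-topdrop-InS {m} {L} {i = i} L∈S refl i<n = begin
  nth (topdrop L) i                                 ≡⟨ nth-topdrop L k≤|L| (subst (i <_) (sym |L|≡n) i<n) ⟩
  nth L (topdropIndex (length L) (first L) i)       ≡⟨ cong (λ n → nth L (topdropIndex n (first L) i)) |L|≡n ⟩
  nth L (topdropIndex (suc m) (first L) i)          ∎
  where
  open ≡-Reasoning
  |L|≡n : length L ≡ suc m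
  |L|≡n = length-InS L∈S
  k≤|L| : first L ≤ length L
  k≤|L| = subst (first L ≤_) (sym |L|≡n) (proj₂ (first-InS L∈S))

necklace-from-entries : ∀ {m π a b c d e} → InS (suc m) π →
  a < suc m → b < suc m → c < suc m → m ≤ d → m ≤ e →
  nth π 0 ≡ a → nth π a ≡ b → nth π (topdropIndex (suc m) a b) ≡ c →
  nth π (topdropIndex (suc m) a (topdropIndex (suc m) b c)) ≡ d → nth π m ≡ e →
  b ≢ a → c ≢ a → d ≢ a → e ≢ a → e ≢ b →
  TopdropValid (suc m) (a ∷ b ∷ c ∷ d ∷ c ∷ b ∷ a ∷ e ∷ [])
necklace-from-entries {m} {π} {a} {b} {c} {d} {e} π∈S a<n b<n c<n m≤d m≤e π₀ π₁ π₂ π₃ πₘ =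
  palindromic-necklace π∈S f₀ f₁ f₂ f₃ fₑ m≤d m≤e
  where
  open ≡-Reasoning
  ι : ℕ → ℕ → ℕ
  ι = topdropIndex (suc m)
  T¹π∈S : InS (suc m) (topdropIter 1 π)
  T¹π∈S = topdrop-InS π∈S
  T²π∈S : InS (suc m) (topdropIter 2 π)
  T²π∈S = topdrop-InS T¹π∈S
  f₀ : first π ≡ a
  f₀ = trans (first≡nth-0 π) π₀
  f₁ : first (topdropIter 1 π) ≡ b
  f₁ = begin
    first (topdropIter 1 π)   ≡⟨ first≡nth-0 (topdropIter 1 π) ⟩
    nth (topdropIter 1 π) 0   ≡⟨ nth-topdrop-InS π∈S f₀ z<s ⟩
    nth π (ι a 0)             ≡⟨ cong (nth π) (topdropIndex-0 a<n) ⟩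
    nth π a                   ≡⟨ π₁ ⟩
    b                         ∎
  f₂ : first (topdropIter 2 π) ≡ c
  f₂ = begin
    first (topdropIter 2 π)   ≡⟨ first≡nth-0 (topdropIter 2 π) ⟩
    nth (topdropIter 2 π) 0   ≡⟨ nth-topdrop-InS T¹π∈S f₁ z<s ⟩
    nth (topdropIter 1 π) (ι b 0) ≡⟨ cong (nth (topdropIter 1 π)) (topdropIndex-0 b<n) ⟩
    nth (topdropIter 1 π) b   ≡⟨ nth-topdrop-InS π∈S f₀ b<n ⟩
    nth π (ι a b)             ≡⟨ π₂ ⟩
    c                         ∎
  f₃ : first (topdropIter 3 π) ≡ d
  f₃ = begin
    first (topdropIter 3 π)   ≡⟨ first≡nth-0 (topdropIter 3 π) ⟩
    nth (topdropIter 3 π) 0   ≡⟨ nth-topdrop-InS T²π∈S f₂ z<s ⟩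
    nth (topdropIter 2 π) (ι c 0) ≡⟨ cong (nth (topdropIter 2 π)) (topdropIndex-0 c<n) ⟩
    nth (topdropIter 2 π) c   ≡⟨ nth-topdrop-InS T¹π∈S f₁ c<n ⟩
    nth (topdropIter 1 π) (ι b c) ≡⟨ nth-topdrop-InS π∈S f₀ (topdropIndex<n (suc m) b c<n) ⟩
    nth π (ι a (ι b c))       ≡⟨ π₃ ⟩
    d                         ∎
  fₑ : first (reverse π) ≡ e
  fₑ = begin
    first (reverse π)         ≡⟨ first-reverse π ⟩
    nth π (length π ∸ 1)      ≡⟨ cong (λ n → nth π (n ∸ 1)) (length-InS π∈S) ⟩
    nth π m                   ≡⟨ πₘ ⟩
    e                         ∎

HasEntry : List ℕ → ℕ × ℕ → Set
HasEntry π (p , w) = nth π p ≡ w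

insertAt : ℕ → ℕ → List ℕ → List ℕ
insertAt p w L = take p L ++ w ∷ drop p L

insertAll : List (ℕ × ℕ) → List ℕ → List ℕ
insertAll []              L = L
insertAll ((p , w) ∷ pws) L = insertAll pws (insertAt p w L)

insertAt-↭ : ∀ p w L → insertAt p w L ↭ w ∷ L
insertAt-↭ p w L = ↭-trans (shift w (take p L) (drop p L)) (prep w (↭-reflexive (take++drop≡id p L)))

insertAll-↭ : ∀ pws L → insertAll pws L ↭ map proj₂ pws ++ L
insertAll-↭ []              L = ↭-refl
insertAll-↭ ((p , w) ∷ pws) L = begin
  insertAll pws (insertAt p w L)   ↭⟨ insertAll-↭ pws (insertAt p w L) ⟩
  ws ++ insertAt p w L             ↭⟨ ++⁺ˡ ws (insertAt-↭ p w L) ⟩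
  ws ++ w ∷ L                      ↭⟨ shift w ws L ⟩
  w ∷ ws ++ L                      ∎
  where
  open PermutationReasoning
  ws = map proj₂ pws

length-insertAt : ∀ p w L → length (insertAt p w L) ≡ suc (length L)
length-insertAt p w L = ↭-length (insertAt-↭ p w L)

nth-insertAt-here : ∀ {p} w L → p ≤ length L → nth (insertAt p w L) p ≡ w
nth-insertAt-here {zero}  w L       _         = refl
nth-insertAt-here {suc p} w (x ∷ L) (s≤s p≤n) = nth-insertAt-here w L p≤n

nth-insertAt-< : ∀ {p j} w L → j < p → j < length L → nth (insertAt p w L) j ≡ nth L j
nth-insertAt-< {suc p} {zero}  w (x ∷ L) _         _         = refl
nth-insertAt-< {suc p} {suc j} w (x ∷ L) (s≤s j<p) (s≤s j<n) = nth-insertAt-< w L j<p j<n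

nth-insertAll-< : ∀ pws L {j} → All (j <_) (map proj₁ pws) → j < length L →
  nth (insertAll pws L) j ≡ nth L j
nth-insertAll-< []              L []            _   = refl
nth-insertAll-< ((p , w) ∷ pws) L (j<p ∷ j<pws) j<n = trans
  (nth-insertAll-< pws (insertAt p w L) j<pws
    (subst (_ <_) (sym (length-insertAt p w L)) (m<n⇒m<1+n j<n)))
  (nth-insertAt-< w L j<p j<n)

ascending-bound : ∀ {p n} qs → Linked _<_ (p ∷ qs ++ [ n ]) → p + length qs < n
ascending-bound {p} []       (p<n ∷ [-])  = subst (_< _) (sym (+-identityʳ p)) p<n
ascending-bound {p} (q ∷ qs) (p<q ∷ q…n) = begin-strict
  p + suc (length qs)   ≡⟨ +-suc p (length qs) ⟩
  suc p + length qs     ≤⟨ +-monoˡ-≤ (length qs) p<q ⟩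
  q + length qs         <⟨ ascending-bound qs q…n ⟩
  _                     ∎
  where open ≤-Reasoning

nth-insertAll : ∀ pws L → Linked _<_ (map proj₁ pws ++ [ length pws + length L ]) →
  All (HasEntry (insertAll pws L)) pws
nth-insertAll []              L _   = []
nth-insertAll ((p , w) ∷ pws) L p…n = p↦w ∷ nth-insertAll pws (insertAt p w L) ps…n
  where
  ps : List ℕ
  ps = map proj₁ pws
  k : ℕ
  k = length pws
  ps…n : Linked _<_ (ps ++ [ k + length (insertAt p w L) ])
  ps…n = subst (λ n → Linked _<_ (ps ++ [ n ]))
           (trans (sym (+-suc k (length L))) (cong (k +_) (sym (length-insertAt p w L))))
           (Linked.tail p…n)
  p+k<1+k+|L| : p + k < suc (k + length L)
  p+k<1+k+|L| = subst (λ j → p + j < suc (k + length L)) (length-map proj₁ pws)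
                  (ascending-bound ps p…n)
  p≤|L| : p ≤ length L
  p≤|L| = +-cancelʳ-≤ k p (length L) (subst (p + k ≤_) (+-comm k (length L)) (s≤s⁻¹ p+k<1+k+|L|))
  p<ps : All (p <_) ps
  p<ps = All.++⁻ˡ ps (AllPairs.head (Linked⇒AllPairs <-trans p…n))
  p↦w : nth (insertAll pws (insertAt p w L)) p ≡ w
  p↦w = trans (nth-insertAll-< pws (insertAt p w L) p<ps
                 (subst (p <_) (sym (length-insertAt p w L)) (s≤s p≤|L|)))
              (nth-insertAt-here w L p≤|L|)

∈-extract : ∀ {v : ℕ} {L} → v ∈ L → ∃[ R ] (L ↭ v ∷ R)
∈-extract {v} v∈L with ys , zs , refl ← ∈-∃++ v∈L = ys ++ zs , shift v ys zs

∈-after-extract : ∀ {v x : ℕ} {L R} → L ↭ v ∷ R → x ∈ L → v ≢ x → x ∈ R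
∈-after-extract L↭v∷R x∈L v≢x with ∈-resp-↭ L↭v∷R x∈L
... | here x≡v  = contradiction (sym x≡v) v≢x
... | there x∈R = x∈R

↭-extract : ∀ {L} ws → AllPairs _≢_ ws → All (_∈ L) ws → ∃[ R ] (L ↭ ws ++ R)
↭-extract []       _                      _              = _ , ↭-refl
↭-extract (w ∷ ws) (w≢ws ∷ ws-distinct) (w∈L ∷ ws∈L)
  with R₁ , L↭w∷R₁ ← ∈-extract w∈L
  with R , R₁↭ws++R ← ↭-extract ws ws-distinct
                        (zipWith (λ (x∈L , w≢x) → ∈-after-extract L↭w∷R₁ x∈L w≢x) (ws∈L , w≢ws))
  = R , ↭-trans L↭w∷R₁ (prep w R₁↭ws++R)

-- The positions of the prescribed entries pws are distinct, as witnessed by their ascending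
-- rearrangement qws.
permutation-with-entries : ∀ n pws qws → pws ↭ qws → Linked _<_ (map proj₁ qws ++ [ n ]) →
  AllPairs _≢_ (map proj₂ pws) → All (_∈ oneToN n) (map proj₂ pws) →
  ∃[ π ] (InS n π × All (HasEntry π) pws)
permutation-with-entries n pws qws pws↭qws qs…n ws-distinct ws∈[n]
  with R , [n]↭ws++R ← ↭-extract (map proj₂ pws) ws-distinct ws∈[n]
  = π , π↭[n] , All-resp-↭ (↭-sym pws↭qws) (nth-insertAll qws R qs…|π|)
  where
  π : List ℕ
  π = insertAll qws R
  π↭[n] : π ↭ oneToN n
  π↭[n] = ↭-trans (insertAll-↭ qws R)
            (↭-trans (++⁺ʳ R (↭-map⁺ proj₂ (↭-sym pws↭qws))) (↭-sym [n]↭ws++R))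
  n≡ : n ≡ length qws + length R
  n≡ = begin
    n                                     ≡⟨ length-oneToN n ⟨
    length (oneToN n)                     ≡⟨ ↭-length ([n]↭ws++R) ⟩
    length (map proj₂ pws ++ R)           ≡⟨ length-++ (map proj₂ pws) ⟩
    length (map proj₂ pws) + length R     ≡⟨ cong (_+ length R) (trans (length-map proj₂ pws) (↭-length pws↭qws)) ⟩
    length qws + length R                 ∎
    where open ≡-Reasoning
  qs…|π| : Linked _<_ (map proj₁ qws ++ [ length qws + length R ])
  qs…|π| = subst (λ n → Linked _<_ (map proj₁ qws ++ [ n ])) n≡ qs…n

∈-oneToN : ∀ {v n} → 1 ≤ v → v ≤ n → v ∈ oneToN n
∈-oneToN {suc v} _ v≤n = ∈-map⁺ suc (∈-upTo⁺ v≤n)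

-- π = a ⋯ b ⋯ c ⋯ d in consecutive blocks of lengths a, b, c and 1: each of the first three
-- topdrops peels off one block.
sum-necklace-valid : ∀ {m a b c d} → a + b + c ≡ m → 1 ≤ a → 1 ≤ b → 1 ≤ c → m ≤ d → d ≤ suc m →
  a ≢ b → b ≢ c → a ≢ c → TopdropValid (suc m) (a ∷ b ∷ c ∷ d ∷ c ∷ b ∷ a ∷ d ∷ [])
sum-necklace-valid {m} {a} {b} {c} {d} refl 1≤a 1≤b 1≤c m≤d d≤n a≢b b≢c a≢c =
  from-entries (permutation-with-entries (suc m) entries entries ↭-refl ascending distinct in-range)
  where
  ι : ℕ → ℕ → ℕ
  ι = topdropIndex (suc m)
  entries : List (ℕ × ℕ)
  entries = (0 , a) ∷ (a , b) ∷ (a + b , c) ∷ (a + (b + c) , d) ∷ []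
  a+b<a+[b+c] : a + b < a + (b + c)
  a+b<a+[b+c] = +-monoʳ-< a (m<m+n b 1≤c)
  a+[b+c]<n : a + (b + c) < suc m
  a+[b+c]<n = s≤s (≤-reflexive (sym (+-assoc a b c)))
  ascending : Linked _<_ (0 ∷ a ∷ a + b ∷ a + (b + c) ∷ suc m ∷ [])
  ascending = 1≤a ∷ m<m+n a 1≤b ∷ a+b<a+[b+c] ∷ a+[b+c]<n ∷ [-]
  a<m : a < m
  a<m = <-≤-trans (m<m+n a 1≤b) (m≤m+n (a + b) c)
  b<m : b < m
  b<m = <-≤-trans (m<n+m b 1≤a) (m≤m+n (a + b) c)
  c<m : c < m
  c<m = m<n+m c (≤-trans 1≤a (m≤m+n a b))
  x≢d : ∀ {x} → x < m → x ≢ d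
  x≢d x<m = <⇒≢ (<-≤-trans x<m m≤d)
  distinct : AllPairs _≢_ (a ∷ b ∷ c ∷ d ∷ [])
  distinct = (a≢b ∷ a≢c ∷ x≢d a<m ∷ []) ∷ (b≢c ∷ x≢d b<m ∷ []) ∷ (x≢d c<m ∷ []) ∷ [] ∷ []
  in-range : All (_∈ oneToN (suc m)) (a ∷ b ∷ c ∷ d ∷ [])
  in-range = ∈-oneToN 1≤a (m≤n⇒m≤1+n (<⇒≤ a<m)) ∷ ∈-oneToN 1≤b (m≤n⇒m≤1+n (<⇒≤ b<m))
           ∷ ∈-oneToN 1≤c (m≤n⇒m≤1+n (<⇒≤ c<m)) ∷ ∈-oneToN (≤-trans 1≤a (≤-trans (<⇒≤ a<m) m≤d)) d≤n ∷ []
  ι₂ : ι a b ≡ a + b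
  ι₂ = topdropIndex-< a b (<-trans a+b<a+[b+c] a+[b+c]<n)
  ι₃ : ι a (ι b c) ≡ a + (b + c)
  ι₃ = trans (cong (ι a) (topdropIndex-< b c (≤-trans (s≤s (m≤n+m (b + c) a)) a+[b+c]<n)))
             (topdropIndex-< a (b + c) a+[b+c]<n)
  from-entries : ∃[ π ] (InS (suc m) π × All (HasEntry π) entries) →
    TopdropValid (suc m) (a ∷ b ∷ c ∷ d ∷ c ∷ b ∷ a ∷ d ∷ [])
  from-entries (π , π∈S , π₀ ∷ π₁ ∷ π₂ ∷ π₃ ∷ []) =
    necklace-from-entries π∈S (s≤s (<⇒≤ a<m)) (s≤s (<⇒≤ b<m)) (s≤s (<⇒≤ c<m)) m≤d m≤d
      π₀ π₁ (trans (cong (nth π) ι₂) π₂) (trans (cong (nth π) ι₃) π₃) (trans (cong (nth π) (+-assoc a b c)) π₃)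
      (≢-sym a≢b) (≢-sym a≢c) (≢-sym (x≢d a<m)) (≢-sym (x≢d a<m)) (≢-sym (x≢d b<m))

module NonSumNecklace {M a b c : ℕ} (1≤a : 1 ≤ a) (1≤b : 1 ≤ b) (1≤c : 1 ≤ c)
  (a<M : a < M) (b<M : b < M) (c<M : c < M) (a≢b : a ≢ b) (b≢c : b ≢ c) (a≢c : a ≢ c) where

  N : ℕ
  N = suc M

  necklace : List ℕ
  necklace = a ∷ b ∷ c ∷ M ∷ c ∷ b ∷ a ∷ N ∷ []

  ι : ℕ → ℕ → ℕ
  ι = topdropIndex N

  x<N : ∀ {x} → x < M → x < N
  x<N = m<n⇒m<1+n

  entries : ℕ → ℕ → List (ℕ × ℕ)
  entries p₂ p₃ = (0 , a) ∷ (a , b) ∷ (p₂ , c) ∷ (p₃ , M) ∷ (M , N) ∷ []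

  distinct : AllPairs _≢_ (a ∷ b ∷ c ∷ M ∷ N ∷ [])
  distinct = (a≢b ∷ a≢c ∷ <⇒≢ a<M ∷ <⇒≢ (x<N a<M) ∷ [])
           ∷ (b≢c ∷ <⇒≢ b<M ∷ <⇒≢ (x<N b<M) ∷ [])
           ∷ (<⇒≢ c<M ∷ <⇒≢ (x<N c<M) ∷ [])
           ∷ (<⇒≢ (n<1+n M) ∷ []) ∷ [] ∷ []

  in-range : All (_∈ oneToN N) (a ∷ b ∷ c ∷ M ∷ N ∷ [])
  in-range = ∈-oneToN 1≤a (<⇒≤ (x<N a<M)) ∷ ∈-oneToN 1≤b (<⇒≤ (x<N b<M)) ∷ ∈-oneToN 1≤c (<⇒≤ (x<N c<M))
           ∷ ∈-oneToN (≤-trans 1≤a (<⇒≤ a<M)) (n≤1+n M) ∷ ∈-oneToN (s≤s z≤n) ≤-refl ∷ []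

  valid-if-arranged : ∀ {p₂ p₃ qws} → ι a b ≡ p₂ → ι a (ι b c) ≡ p₃ →
    entries p₂ p₃ ↭ qws → Linked _<_ (map proj₁ qws ++ [ N ]) → TopdropValid N necklace
  valid-if-arranged {p₂} {p₃} {qws} ι₂ ι₃ entries↭qws ascending =
    from-entries (permutation-with-entries N (entries p₂ p₃) qws entries↭qws ascending distinct in-range)
    where
    from-entries : ∃[ π ] (InS N π × All (HasEntry π) (entries p₂ p₃)) → TopdropValid N necklace
    from-entries (π , π∈S , π₀ ∷ π₁ ∷ π₂ ∷ π₃ ∷ πₘ ∷ []) =
      necklace-from-entries π∈S (x<N a<M) (x<N b<M) (x<N c<M) ≤-refl (n≤1+n M)
        π₀ π₁ (trans (cong (nth π) ι₂) π₂) (trans (cong (nth π) ι₃) π₃) πₘ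
        (≢-sym a≢b) (≢-sym a≢c) (≢-sym (<⇒≢ a<M)) (≢-sym (<⇒≢ (x<N a<M))) (≢-sym (<⇒≢ (x<N b<M)))

  ι-forward : ∀ k i → k + i < M → ι k i ≡ k + i
  ι-forward k i k+i<M = topdropIndex-< k i (x<N k+i<M)

  ι-reflect : ∀ k i → M < k + i → ι k i ≡ M ∸ i
  ι-reflect k i = topdropIndex-≥ k i

  M∸x<y : ∀ {x y} → 1 ≤ y → M < x + y → M ∸ x < y
  M∸x<y {x} {y} 1≤y M<x+y = m<n+o⇒m∸n<o M x {{>-nonZero 1≤y}} M<x+y

  0<M∸x : ∀ {x} → x < M → 0 < M ∸ x
  0<M∸x = m<n⇒0<n∸m

  -- The six cases differ in the order of the positions 0, a, ι a b, ι a (ι b c), M of the entries.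
  valid-a+[b+c]<M : a + (b + c) < M → TopdropValid N necklace
  valid-a+[b+c]<M a+[b+c]<M = valid-if-arranged ι₂ ι₃ ↭-refl ascending
    where
    a+b<a+[b+c] : a + b < a + (b + c)
    a+b<a+[b+c] = +-monoʳ-< a (m<m+n b 1≤c)
    ι₂ : ι a b ≡ a + b
    ι₂ = ι-forward a b (<-trans a+b<a+[b+c] a+[b+c]<M)
    ι₃ : ι a (ι b c) ≡ a + (b + c)
    ι₃ = trans (cong (ι a) (ι-forward b c (<-≤-trans (s≤s (m≤n+m (b + c) a)) a+[b+c]<M)))
               (ι-forward a (b + c) a+[b+c]<M)
    ascending : Linked _<_ (0 ∷ a ∷ a + b ∷ a + (b + c) ∷ M ∷ N ∷ [])
    ascending = 1≤a ∷ m<m+n a 1≤b ∷ a+b<a+[b+c] ∷ a+[b+c]<M ∷ n<1+n M ∷ [-]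

  valid-b+c<M<a+[b+c] : a + b < M → b + c < M → M < a + (b + c) → TopdropValid N necklace
  valid-b+c<M<a+[b+c] a+b<M b+c<M M<a+[b+c] = valid-if-arranged ι₂ ι₃
    (prep (0 , a) (shift (M ∸ (b + c) , M) ((a , b) ∷ (a + b , c) ∷ []) ((M , N) ∷ [])))
    ascending
    where
    ι₂ : ι a b ≡ a + b
    ι₂ = ι-forward a b a+b<M
    ι₃ : ι a (ι b c) ≡ M ∸ (b + c)
    ι₃ = trans (cong (ι a) (ι-forward b c b+c<M)) (ι-reflect a (b + c) M<a+[b+c])
    ascending : Linked _<_ (0 ∷ M ∸ (b + c) ∷ a ∷ a + b ∷ M ∷ N ∷ [])
    ascending = 0<M∸x b+c<M ∷ M∸x<y 1≤a (subst (M <_) (+-comm a (b + c)) M<a+[b+c])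
              ∷ m<m+n a 1≤b ∷ a+b<M ∷ n<1+n M ∷ [-]

  valid-b+c<M<a+b : M < a + b → b + c < M → TopdropValid N necklace
  valid-b+c<M<a+b M<a+b b+c<M = valid-if-arranged ι₂ ι₃
    (prep (0 , a) (↭-trans (shift (M ∸ (b + c) , M) ((a , b) ∷ (M ∸ b , c) ∷ []) ((M , N) ∷ []))
                           (prep (M ∸ (b + c) , M) (swap (a , b) (M ∸ b , c) ↭-refl))))
    ascending
    where
    ι₂ : ι a b ≡ M ∸ b
    ι₂ = ι-reflect a b M<a+b
    ι₃ : ι a (ι b c) ≡ M ∸ (b + c)
    ι₃ = trans (cong (ι a) (ι-forward b c b+c<M))
               (ι-reflect a (b + c) (<-≤-trans M<a+b (+-monoʳ-≤ a (m≤m+n b c))))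
    ascending : Linked _<_ (0 ∷ M ∸ (b + c) ∷ M ∸ b ∷ a ∷ M ∷ N ∷ [])
    ascending = 0<M∸x b+c<M ∷ ∸-monoʳ-< (m<m+n b 1≤c) (<⇒≤ b+c<M)
              ∷ M∸x<y 1≤a (subst (M <_) (+-comm a b) M<a+b) ∷ a<M ∷ n<1+n M ∷ [-]

  valid-a+b<M<b+c : a + b < M → M < b + c → TopdropValid N necklace
  valid-a+b<M<b+c a+b<M M<b+c = valid-if-arranged ι₂ ι₃
    (prep (0 , a) (prep (a , b) (swap (a + b , c) (a + (M ∸ c) , M) ↭-refl)))
    ascending
    where
    a+[M∸c]<a+b : a + (M ∸ c) < a + b
    a+[M∸c]<a+b = +-monoʳ-< a (M∸x<y 1≤b (subst (M <_) (+-comm b c) M<b+c))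
    ι₂ : ι a b ≡ a + b
    ι₂ = ι-forward a b a+b<M
    ι₃ : ι a (ι b c) ≡ a + (M ∸ c)
    ι₃ = trans (cong (ι a) (ι-reflect b c M<b+c)) (ι-forward a (M ∸ c) (<-trans a+[M∸c]<a+b a+b<M))
    ascending : Linked _<_ (0 ∷ a ∷ a + (M ∸ c) ∷ a + b ∷ M ∷ N ∷ [])
    ascending = 1≤a ∷ m<m+n a (0<M∸x c<M) ∷ a+[M∸c]<a+b ∷ a+b<M ∷ n<1+n M ∷ [-]

  valid-a<c : M < a + b → M < b + c → a < c → TopdropValid N necklace
  valid-a<c M<a+b M<b+c a<c = valid-if-arranged ι₂ ι₃
    (prep (0 , a) (swap (a , b) (M ∸ b , c) ↭-refl))
    ascending
    where
    a+[M∸c]<M : a + (M ∸ c) < M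
    a+[M∸c]<M = <-≤-trans (+-monoˡ-< (M ∸ c) a<c) (≤-reflexive (m+[n∸m]≡n (<⇒≤ c<M)))
    ι₂ : ι a b ≡ M ∸ b
    ι₂ = ι-reflect a b M<a+b
    ι₃ : ι a (ι b c) ≡ a + (M ∸ c)
    ι₃ = trans (cong (ι a) (ι-reflect b c M<b+c)) (ι-forward a (M ∸ c) a+[M∸c]<M)
    ascending : Linked _<_ (0 ∷ M ∸ b ∷ a ∷ a + (M ∸ c) ∷ M ∷ N ∷ [])
    ascending = 0<M∸x b<M ∷ M∸x<y 1≤a (subst (M <_) (+-comm a b) M<a+b)
              ∷ m<m+n a (0<M∸x c<M) ∷ a+[M∸c]<M ∷ n<1+n M ∷ [-]

  valid-c<a : M < a + b → M < b + c → c < a → TopdropValid N necklace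
  valid-c<a M<a+b M<b+c c<a = valid-if-arranged ι₂ ι₃
    (prep (0 , a) (↭-sym (shift (a , b) ((M ∸ b , c) ∷ (c , M) ∷ []) ((M , N) ∷ []))))
    ascending
    where
    M<a+[M∸c] : M < a + (M ∸ c)
    M<a+[M∸c] = ≤-<-trans (≤-reflexive (sym (m+[n∸m]≡n (<⇒≤ c<M)))) (+-monoˡ-< (M ∸ c) c<a)
    ι₂ : ι a b ≡ M ∸ b
    ι₂ = ι-reflect a b M<a+b
    ι₃ : ι a (ι b c) ≡ c
    ι₃ = trans (cong (ι a) (ι-reflect b c M<b+c))
               (trans (ι-reflect a (M ∸ c) M<a+[M∸c]) (m∸[m∸n]≡n (<⇒≤ c<M)))
    ascending : Linked _<_ (0 ∷ M ∸ b ∷ c ∷ a ∷ M ∷ N ∷ [])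
    ascending = 0<M∸x b<M ∷ M∸x<y 1≤c M<b+c ∷ c<a ∷ a<M ∷ n<1+n M ∷ [-]

  valid : a + b + c ≢ M → a + b ≢ M → b + c ≢ M → TopdropValid N necklace
  valid a+b+c≢M a+b≢M b+c≢M with <-cmp (a + b) M | <-cmp (b + c) M
  ... | tri≈ _ a+b≡M _ | _              = contradiction a+b≡M a+b≢M
  ... | _              | tri≈ _ b+c≡M _ = contradiction b+c≡M b+c≢M
  ... | tri> _ _ M<a+b | tri< b+c<M _ _ = valid-b+c<M<a+b M<a+b b+c<M
  ... | tri< a+b<M _ _ | tri> _ _ M<b+c = valid-a+b<M<b+c a+b<M M<b+c
  ... | tri< a+b<M _ _ | tri< b+c<M _ _ with <-cmp (a + (b + c)) M
  ...   | tri< a+[b+c]<M _ _ = valid-a+[b+c]<M a+[b+c]<M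
  ...   | tri≈ _ a+[b+c]≡M _ = contradiction (trans (+-assoc a b c) a+[b+c]≡M) a+b+c≢M
  ...   | tri> _ _ M<a+[b+c] = valid-b+c<M<a+[b+c] a+b<M b+c<M M<a+[b+c]
  valid _ _ _ | tri> _ _ M<a+b | tri> _ _ M<b+c with <-cmp a c
  ...   | tri< a<c _ _ = valid-a<c M<a+b M<b+c a<c
  ...   | tri≈ _ a≡c _ = contradiction a≡c a≢c
  ...   | tri> _ _ c<a = valid-c<a M<a+b M<b+c c<a

lemma4p11 : (n : ℕ) → 4 ≤ n →
    ((a b c : ℕ) → a ≢ b → b ≢ c → a ≢ c →
      1 ≤ a → a ≤ n ∸ 2 → 1 ≤ b → b ≤ n ∸ 2 → 1 ≤ c → c ≤ n ∸ 2 →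
      a + b + c ≡ n ∸ 1 →
      TopdropValid n (a ∷ b ∷ c ∷ n ∷ c ∷ b ∷ a ∷ n ∷ [])
        × TopdropValid n (a ∷ b ∷ c ∷ (n ∸ 1) ∷ c ∷ b ∷ a ∷ (n ∸ 1) ∷ []))
    × ((a b c : ℕ) → a ≢ b → b ≢ c → a ≢ c →
      1 ≤ a → a ≤ n ∸ 2 → 1 ≤ b → b ≤ n ∸ 2 → 1 ≤ c → c ≤ n ∸ 2 →
      a + b + c ≢ n ∸ 1 → a + b ≢ n ∸ 1 → b + c ≢ n ∸ 1 →
      TopdropValid n (a ∷ b ∷ c ∷ (n ∸ 1) ∷ c ∷ b ∷ a ∷ n ∷ []))
lemma4p11 .(suc (suc (suc (suc k)))) (s≤s (s≤s (s≤s (s≤s {n = k} z≤n)))) =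
  (λ a b c a≢b b≢c a≢c 1≤a _ 1≤b _ 1≤c _ a+b+c≡n-1 →
      sum-necklace-valid a+b+c≡n-1 1≤a 1≤b 1≤c (n≤1+n _) ≤-refl a≢b b≢c a≢c
    , sum-necklace-valid a+b+c≡n-1 1≤a 1≤b 1≤c ≤-refl (n≤1+n _) a≢b b≢c a≢c)
  , λ a b c a≢b b≢c a≢c 1≤a a≤n-2 1≤b b≤n-2 1≤c c≤n-2 →
      NonSumNecklace.valid 1≤a 1≤b 1≤c (s≤s a≤n-2) (s≤s b≤n-2) (s≤s c≤n-2) a≢b b≢c a≢c
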